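{- Let $m$ and $n$ be powers of $2$ with $m \geq 16$, $n \geq 4$ and $m \leq 4n$, and let $$G = \langle a, b \mid a^m = 1,\ b^n = 1,\ [b,a] = a^4 \rangle .$$ Then $G$ has order $mn$, its derived subgroup $G' = \langle a^4 \rangle$ is cyclic of order $m/4$, and $G/G'$ is a direct product of a cyclic group of order $4$ and a cyclic group of order $n$.
   Context: The commutator convention is $[x,y] = x^{ -1}y^{ -1}xy$. -}

module Defs where

open import Level using (Level; _⊔_; 0ℓ)
open import Data.Nat as ℕ using (ℕ; zero; suc; _≤_; _<_)
open import Data.Nat.DivMod using (_mod_)
open import Data.Integer using (ℤ; +_; -[1+_])
open import Data.Fin using (Fin; toℕ)
open import Data.Product using (_×_; _,_; ∃-syntax)
open import Relation.Nullary using (¬_)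
open import Relation.Binary.Bundles using (Setoid)
open import Relation.Binary.Structures using (IsEquivalence)
import Relation.Binary.PropositionalEquality as ≡
open import Algebra.Bundles using (Group)
open import Algebra.Structures using (IsGroup; IsMonoid; IsSemigroup; IsMagma)
open import Function.Bundles using (Bijection)
import Algebra.Properties.Group as GP
import Relation.Binary.Reasoning.Setoid as SR

IsPow2 : ℕ → Set
IsPow2 m = ∃[ k ] m ≡.≡ 2 ℕ.^ k

module _ {c ℓ : Level} (G : Group c ℓ) where
  open Group G

  pow : Carrier → ℕ → Carrier
  pow x zero    = ε
  pow x (suc k) = x ∙ pow x k

  powℤ : Carrier → ℤ → Carrier
  powℤ x (+ k)      = pow x k
  powℤ x -[1+ k ]   = (pow x (suc k)) ⁻¹

  comm : Carrier → Carrier → Carrier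
  comm x y = ((x ⁻¹ ∙ y ⁻¹) ∙ x) ∙ y

  data InDerived : Carrier → Set (c ⊔ ℓ) where
    d-comm : ∀ x y → InDerived (comm x y)
    d-ε    : InDerived ε
    d-∙    : ∀ {x y} → InDerived x → InDerived y → InDerived (x ∙ y)
    d-⁻¹   : ∀ {x} → InDerived x → InDerived (x ⁻¹)
    d-resp : ∀ {x y} → x ≈ y → InDerived x → InDerived y

  InCyclic : Carrier → Carrier → Set ℓ
  InCyclic g x = ∃[ k ] x ≈ powℤ g k

  HasOrder : Carrier → ℕ → Set ℓ
  HasOrder g k = (1 ≤ k) × (pow g k ≈ ε) × (∀ j → 1 ≤ j → j < k → ¬ (pow g j ≈ ε))

  private
    module P = GP G
    open SR setoid

  quotDerivedSetoid : Setoid c (c ⊔ ℓ)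
  quotDerivedSetoid = record
    { Carrier = Carrier
    ; _≈_ = λ x y → InDerived (x ⁻¹ ∙ y)
    ; isEquivalence = record
      { refl  = λ {x} → d-resp (sym (inverseˡ x)) d-ε
      ; sym   = λ {x} {y} p → d-resp (s x y) (d-⁻¹ p)
      ; trans = λ {x} {y} {z} p q → d-resp (t x y z) (d-∙ p q)
      }
    }
    where
    s : ∀ x y → (x ⁻¹ ∙ y) ⁻¹ ≈ y ⁻¹ ∙ x
    s x y = begin
      (x ⁻¹ ∙ y) ⁻¹      ≈⟨ P.⁻¹-anti-homo-∙ (x ⁻¹) y ⟩
      y ⁻¹ ∙ (x ⁻¹) ⁻¹   ≈⟨ ∙-congˡ (P.⁻¹-involutive x) ⟩
      y ⁻¹ ∙ x           ∎
    t : ∀ x y z → (x ⁻¹ ∙ y) ∙ (y ⁻¹ ∙ z) ≈ x ⁻¹ ∙ z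
    t x y z = begin
      (x ⁻¹ ∙ y) ∙ (y ⁻¹ ∙ z)   ≈⟨ assoc (x ⁻¹) y (y ⁻¹ ∙ z) ⟩
      x ⁻¹ ∙ (y ∙ (y ⁻¹ ∙ z))   ≈⟨ ∙-congˡ (sym (assoc y (y ⁻¹) z)) ⟩
      x ⁻¹ ∙ ((y ∙ y ⁻¹) ∙ z)   ≈⟨ ∙-congˡ (∙-congʳ (inverseʳ y)) ⟩
      x ⁻¹ ∙ (ε ∙ z)            ≈⟨ ∙-congˡ (identityˡ z) ⟩
      x ⁻¹ ∙ z                  ∎

-- Cyclic group C_k realised as Fin k under addition mod k,
-- and the direct product C_k × C_l

addMod : ∀ {k} → Fin k → Fin k → Fin k
addMod {suc k} i j = (toℕ i ℕ.+ toℕ j) mod (suc k)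

addPair : ∀ {k l} → Fin k × Fin l → Fin k × Fin l → Fin k × Fin l
addPair (i , j) (i′ , j′) = addMod i i′ , addMod j j′

QuotDerivedIsoCk×Cl : ∀ {c ℓ} (G : Group c ℓ) (k l : ℕ) → Set _
QuotDerivedIsoCk×Cl G k l =
  Data.Product.Σ (Bijection (quotDerivedSetoid G) (≡.setoid (Fin k × Fin l)))
    λ f → ∀ x y → Bijection.to f (Group._∙_ G x y)
                  ≡.≡ addPair (Bijection.to f x) (Bijection.to f y)

-- The finitely presented group ⟨ a, b | a^m = 1, b^n = 1, [b,a] = a^4 ⟩
-- realised as words modulo the congruence generated by the group axioms
-- and the defining relators.

data Word : Set where
  ga gb : Word
  e     : Word
  _·_   : Word → Word → Word
  inv   : Word → Word

powW : Word → ℕ → Word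
powW x zero    = e
powW x (suc k) = x · powW x k

module _ (m n : ℕ) where

  data _∼_ : Word → Word → Set where
    ∼-refl  : ∀ {x} → x ∼ x
    ∼-sym   : ∀ {x y} → x ∼ y → y ∼ x
    ∼-trans : ∀ {x y z} → x ∼ y → y ∼ z → x ∼ z
    ∼-·     : ∀ {x x′ y y′} → x ∼ x′ → y ∼ y′ → (x · y) ∼ (x′ · y′)
    ∼-inv   : ∀ {x x′} → x ∼ x′ → inv x ∼ inv x′
    ∼-assoc : ∀ x y z → ((x · y) · z) ∼ (x · (y · z))
    ∼-idˡ   : ∀ x → (e · x) ∼ x
    ∼-idʳ   : ∀ x → (x · e) ∼ x
    ∼-invˡ  : ∀ x → (inv x · x) ∼ e
    ∼-invʳ  : ∀ x → (x · inv x) ∼ e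
    rel-a   : powW ga m ∼ e
    rel-b   : powW gb n ∼ e
    rel-ba  : (((inv gb · inv ga) · gb) · ga) ∼ powW ga 4

  Pres : Group 0ℓ 0ℓ
  Pres = record
    { Carrier = Word
    ; _≈_ = _∼_
    ; _∙_ = _·_
    ; ε = e
    ; _⁻¹ = inv
    ; isGroup = record
      { isMonoid = record
        { isSemigroup = record
          { isMagma = record
            { isEquivalence = record { refl = ∼-refl ; sym = ∼-sym ; trans = ∼-trans }
            ; ∙-cong = ∼-·
            }
          ; assoc = ∼-assoc
          }
        ; identity = ∼-idˡ , ∼-idʳ
        }
      ; inverse = ∼-invˡ , ∼-invʳ
      ; ⁻¹-cong = ∼-inv
      }
    }

-- Put t = m ∸ 3, so t ≡ −3 (mod m). The relation [b,a] = a⁴ says b⁻¹ab = aᵗ, hence every element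
-- of G is a normal form bʲaⁱ. Since m ∣ 4n and 9^(2^s) ≡ 1 (mod 2^(s+3)), also tⁿ ≡ 1 (mod m), so
-- the semidirect product ℤ/n ⋉ ℤ/m in which b acts by a ↦ aᵗ satisfies the defining relations;
-- evaluating words there separates the mn normal forms. The relations also hold in the abelian
-- group ℤ/n × ℤ/4, so G′ lies in the kernel of that evaluation. That kernel is ⟨a⁴⟩, and
-- a⁴ = [b,a] ∈ G′, so G′ = ⟨a⁴⟩; it has order m/4 because a has order m, and G/G′ ≅ C₄ × Cₙ.
module Submission where

open import Defs
open import Data.Nat using (ℕ; _≤_; _*_; _/_)
open import Data.Fin using (Fin)
open import Data.Product using (_×_)
open import Algebra.Bundles using (Group)
open import Function.Bundles using (Bijection; _⇔_)
open import Relation.Binary.PropositionalEquality using (setoid)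

open import Level using (Level; 0ℓ)
open import Data.Nat
open import Data.Nat.Properties
open import Data.Nat.DivMod
open import Data.Nat.Divisibility using (_∣_; divides; n∣m⇒m%n≡0; m%n≡0⇒n∣m; ∣-refl; ∣⇒≤; m∣m*n)
open import Data.Nat.Tactic.RingSolver using (solve-∀)
open import Data.Integer using (+_; -[1+_])
open import Data.Fin using (toℕ)
open import Data.Fin.Properties using (toℕ-fromℕ<; toℕ-injective; toℕ<n; *↔×)
open import Data.Product using (_,_; ∃; proj₁; proj₂)
open import Relation.Nullary using (¬_)
open import Relation.Binary.PropositionalEquality as ≡ using (_≡_; refl; cong; cong₂; module ≡-Reasoning)
open import Function.Bundles using (mk⇔)
open import Function.Properties.Inverse using (Inverse⇒Bijection)
import Function.Construct.Composition as Composition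
import Algebra.Properties.Group as GP
import Algebra.Properties.Monoid.Mult as Mult
import Relation.Binary.Reasoning.Setoid as SR

-- Written x ≡ y [mod d ]: the space before ] is needed, as d] would lex as a single name.
infix 4 _≡_[mod_]
_≡_[mod_] : ℕ → ℕ → (d : ℕ) .{{_ : NonZero d}} → Set
_≡_[mod_] x y d = x % d ≡ y % d

module _ {d : ℕ} .{{_ : NonZero d}} where
  open ≡-Reasoning

  +-cong-mod : ∀ {x x′ y y′} → x ≡ x′ [mod d ] → y ≡ y′ [mod d ] → x + y ≡ x′ + y′ [mod d ]
  +-cong-mod {x} {x′} {y} {y′} x≡x′ y≡y′ = begin
    (x + y) % d            ≡⟨ %-distribˡ-+ x y d ⟩
    (x % d + y % d) % d    ≡⟨ cong₂ (λ u v → (u + v) % d) x≡x′ y≡y′ ⟩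
    (x′ % d + y′ % d) % d  ≡⟨ %-distribˡ-+ x′ y′ d ⟨
    (x′ + y′) % d          ∎

  *-cong-mod : ∀ {x x′ y y′} → x ≡ x′ [mod d ] → y ≡ y′ [mod d ] → x * y ≡ x′ * y′ [mod d ]
  *-cong-mod {x} {x′} {y} {y′} x≡x′ y≡y′ = begin
    (x * y) % d            ≡⟨ %-distribˡ-* x y d ⟩
    (x % d * (y % d)) % d  ≡⟨ cong₂ (λ u v → (u * v) % d) x≡x′ y≡y′ ⟩
    (x′ % d * (y′ % d)) % d ≡⟨ %-distribˡ-* x′ y′ d ⟨
    (x′ * y′) % d          ∎

  ^-congˡ-mod : ∀ {x y} k → x ≡ y [mod d ] → x ^ k ≡ y ^ k [mod d ]
  ^-congˡ-mod zero    x≡y = refl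
  ^-congˡ-mod (suc k) x≡y = *-cong-mod x≡y (^-congˡ-mod k x≡y)

  ∣⇒≡0-mod : ∀ {x} → d ∣ x → x ≡ 0 [mod d ]
  ∣⇒≡0-mod d∣x = ≡.trans (n∣m⇒m%n≡0 _ d d∣x) (≡.sym (m<n⇒m%n≡m (>-nonZero⁻¹ d)))

  <⇒≡0-mod⇒≡0 : ∀ {x} → x < d → x ≡ 0 [mod d ] → x ≡ 0
  <⇒≡0-mod⇒≡0 x<d x≡0 = ≡.trans (≡.sym (m<n⇒m%n≡m x<d)) (≡.trans x≡0 (m<n⇒m%n≡m (>-nonZero⁻¹ d)))

  [d∸1]*x+x≡0 : ∀ x → (d ∸ 1) * x + x ≡ 0 [mod d ]
  [d∸1]*x+x≡0 x = begin
    ((d ∸ 1) * x + x) % d  ≡⟨ cong (_% d) (multiple (d ∸ 1) x) ⟩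
    (0 + x * suc (d ∸ 1)) % d ≡⟨ cong (λ e → (0 + x * e) % d) (suc-pred d) ⟩
    (0 + x * d) % d        ≡⟨ [m+kn]%n≡m%n 0 x d ⟩
    0 % d                  ∎
    where
    multiple : ∀ p x → p * x + x ≡ 0 + x * suc p
    multiple = solve-∀

  x+[d∸1]*x≡0 : ∀ x → x + (d ∸ 1) * x ≡ 0 [mod d ]
  x+[d∸1]*x≡0 x = ≡.trans (cong (_% d) (+-comm x _)) ([d∸1]*x+x≡0 x)

  [d∸1]*t+1≡4 : ∀ {t} → t + 3 ≡ 0 [mod d ] → (d ∸ 1) * t + 1 ≡ 4 [mod d ]
  [d∸1]*t+1≡4 {t} t+3≡0 = begin
    ((d ∸ 1) * t + 1) % d             ≡⟨ [m+kn]%n≡m%n _ 3 d ⟨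
    ((d ∸ 1) * t + 1 + 3 * d) % d     ≡⟨ cong (λ e → ((d ∸ 1) * t + 1 + 3 * e) % d) (suc-pred d) ⟨
    ((d ∸ 1) * t + 1 + 3 * suc (d ∸ 1)) % d ≡⟨ cong (_% d) (regroup (d ∸ 1) t) ⟩
    ((d ∸ 1) * (t + 3) + 4) % d       ≡⟨ +-cong-mod (*-cong-mod {x = d ∸ 1} refl t+3≡0) refl ⟩
    ((d ∸ 1) * 0 + 4) % d             ≡⟨ cong (λ e → (e + 4) % d) (*-zeroʳ (d ∸ 1)) ⟩
    4 % d                             ∎
    where
    regroup : ∀ p t → p * t + 1 + 3 * suc p ≡ p * (t + 3) + 4
    regroup = solve-∀

  module _ {t n : ℕ} .{{_ : NonZero n}} (tⁿ≡1 : t ^ n ≡ 1 [mod d ]) where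

    ^-congʳ-mod : ∀ {l l′} → l ≡ l′ [mod n ] → t ^ l ≡ t ^ l′ [mod d ]
    ^-congʳ-mod {l} {l′} l≡l′ = ≡.trans (reduce l) (≡.trans (cong (λ e → t ^ e % d) l≡l′) (≡.sym (reduce l′)))
      where
      reduce : ∀ k → t ^ k ≡ t ^ (k % n) [mod d ]
      reduce k = begin
        t ^ k % d                               ≡⟨ cong (λ e → t ^ e % d) (m≡m%n+[m/n]*n k n) ⟩
        t ^ (k % n + k / n * n) % d             ≡⟨ cong (_% d) (^-distribˡ-+-* t (k % n) _) ⟩
        t ^ (k % n) * t ^ (k / n * n) % d       ≡⟨ cong (λ e → t ^ (k % n) * t ^ e % d) (*-comm (k / n) n) ⟩
        t ^ (k % n) * t ^ (n * (k / n)) % d     ≡⟨ cong (λ e → t ^ (k % n) * e % d) (^-*-assoc t n (k / n)) ⟨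
        t ^ (k % n) * (t ^ n) ^ (k / n) % d     ≡⟨ *-cong-mod {x = t ^ (k % n)} refl (^-congˡ-mod (k / n) tⁿ≡1) ⟩
        t ^ (k % n) * 1 ^ (k / n) % d           ≡⟨ cong (λ e → t ^ (k % n) * e % d) (^-zeroˡ (k / n)) ⟩
        t ^ (k % n) * 1 % d                     ≡⟨ cong (_% d) (*-identityʳ _) ⟩
        t ^ (k % n) % d                         ∎

x*1^l≡x : ∀ x l → x * 1 ^ l ≡ x
x*1^l≡x x l = ≡.trans (cong (x *_) (^-zeroˡ l)) (*-identityʳ x)

module _ {d : ℕ} .{{_ : NonZero d}} where

  toℕ-mod : ∀ x → toℕ (x mod d) ≡ x % d
  toℕ-mod x = toℕ-fromℕ< (m%n<n x d)

  toℕ-mod-≡ : ∀ x → toℕ (x mod d) ≡ x [mod d ]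
  toℕ-mod-≡ x = ≡.trans (cong (_% d) (toℕ-mod x)) (m%n%n≡m%n x d)

  mod-cong : ∀ {x y} → x ≡ y [mod d ] → x mod d ≡ y mod d
  mod-cong {x} {y} x≡y = toℕ-injective (≡.trans (toℕ-mod x) (≡.trans x≡y (≡.sym (toℕ-mod y))))

  mod-injective : ∀ x y → x mod d ≡ y mod d → x ≡ y [mod d ]
  mod-injective x y eq = ≡.trans (≡.sym (toℕ-mod x)) (≡.trans (cong toℕ eq) (toℕ-mod y))

  toℕ-mod-id : ∀ (i : Fin d) → toℕ i mod d ≡ i
  toℕ-mod-id i = toℕ-injective (≡.trans (toℕ-mod (toℕ i)) (m<n⇒m%n≡m (toℕ<n i)))

  toℕ-injective-mod : ∀ {i j : Fin d} → toℕ i ≡ toℕ j [mod d ] → i ≡ j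
  toℕ-injective-mod {i} {j} eq = ≡.trans (≡.sym (toℕ-mod-id i)) (≡.trans (mod-cong eq) (toℕ-mod-id j))

mod-distrib-+ : ∀ {d} .{{_ : NonZero d}} x y → (x + y) mod d ≡ addMod (x mod d) (y mod d)
mod-distrib-+ {suc d} x y = mod-cong {x = x + y} {toℕ (x mod suc d) + toℕ (y mod suc d)} (begin
  (x + y) % suc d                                   ≡⟨ %-distribˡ-+ x y (suc d) ⟩
  (x % suc d + y % suc d) % suc d                   ≡⟨ cong₂ (λ u v → (u + v) % suc d) (toℕ-mod x) (toℕ-mod y) ⟨
  (toℕ (x mod suc d) + toℕ (y mod suc d)) % suc d   ∎)
  where open ≡-Reasoning

9^2^s≡1+q*2^[3+s] : ∀ s → ∃ λ q → 9 ^ (2 ^ s) ≡ 1 + q * 2 ^ (3 + s)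
9^2^s≡1+q*2^[3+s] zero    = 1 , refl
9^2^s≡1+q*2^[3+s] (suc s) with q , eq ← 9^2^s≡1+q*2^[3+s] s =
  q + q * q * 2 ^ (2 + s) , (begin
    9 ^ (2 ^ s + (2 ^ s + 0))       ≡⟨ ^-distribˡ-+-* 9 (2 ^ s) _ ⟩
    9 ^ 2 ^ s * 9 ^ (2 ^ s + 0)     ≡⟨ cong (λ e → 9 ^ 2 ^ s * 9 ^ e) (+-identityʳ (2 ^ s)) ⟩
    9 ^ 2 ^ s * 9 ^ 2 ^ s           ≡⟨ cong₂ _*_ eq eq ⟩
    (1 + q * (2 * R)) * (1 + q * (2 * R)) ≡⟨ square q R ⟩
    1 + (q + q * q * R) * (2 * (2 * R)) ∎)
  where
  open ≡-Reasoning
  R = 2 ^ (2 + s)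
  square : ∀ q R → (1 + q * (2 * R)) * (1 + q * (2 * R)) ≡ 1 + (q + q * q * R) * (2 * (2 * R))
  square = solve-∀

^-cancelʳ-≤ : ∀ m {a b} → 1 < m → m ^ a ≤ m ^ b → a ≤ b
^-cancelʳ-≤ m 1<m mᵃ≤mᵇ = ≮⇒≥ (λ b<a → <⇒≱ (^-monoʳ-< m 1<m b<a) mᵃ≤mᵇ)

^-monoʳ-∣ : ∀ m {a b} → a ≤ b → m ^ a ∣ m ^ b
^-monoʳ-∣ m {a} {b} a≤b = ≡.subst (m ^ a ∣_) mᵃ*mᵇ⁻ᵃ≡mᵇ (m∣m*n (m ^ (b ∸ a)))
  where
  mᵃ*mᵇ⁻ᵃ≡mᵇ : m ^ a * m ^ (b ∸ a) ≡ m ^ b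
  mᵃ*mᵇ⁻ᵃ≡mᵇ = ≡.trans (≡.sym (^-distribˡ-+-* m a (b ∸ a))) (cong (m ^_) (m+[n∸m]≡n a≤b))

module _ {d : ℕ} .{{_ : NonZero d}} (3≤d : 3 ≤ d) where
  open ≡-Reasoning

  [d∸3]^2≡9 : (d ∸ 3) ^ 2 ≡ 9 [mod d ]
  [d∸3]^2≡9 = begin
    c ^ 2 % d                 ≡⟨ [m+kn]%n≡m%n (c ^ 2) 6 d ⟨
    (c ^ 2 + 6 * d) % d       ≡⟨ cong (λ e → (c ^ 2 + 6 * e) % d) d≡c+3 ⟩
    (c ^ 2 + 6 * (c + 3)) % d ≡⟨ cong (_% d) (complete-square c) ⟩
    (9 + (c + 3) * (c + 3)) % d ≡⟨ cong (λ e → (9 + e * e) % d) d≡c+3 ⟨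
    (9 + d * d) % d           ≡⟨ [m+kn]%n≡m%n 9 d d ⟩
    9 % d                     ∎
    where
    c = d ∸ 3
    d≡c+3 : d ≡ c + 3
    d≡c+3 = ≡.sym (m∸n+n≡m 3≤d)
    complete-square : ∀ c → c * (c * 1) + 6 * (c + 3) ≡ 9 + (c + 3) * (c + 3)
    complete-square = solve-∀

  [d∸3]^2^[1+s]≡1 : ∀ s → d ∣ 2 ^ (3 + s) → (d ∸ 3) ^ (2 ^ (1 + s)) ≡ 1 [mod d ]
  [d∸3]^2^[1+s]≡1 s (divides r 2^[3+s]≡r*d) with q , 9^2^s≡1+q*2^[3+s] ← 9^2^s≡1+q*2^[3+s] s = begin
    (d ∸ 3) ^ (2 * 2 ^ s) % d   ≡⟨ cong (_% d) (^-*-assoc (d ∸ 3) 2 (2 ^ s)) ⟨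
    ((d ∸ 3) ^ 2) ^ 2 ^ s % d   ≡⟨ ^-congˡ-mod (2 ^ s) [d∸3]^2≡9 ⟩
    9 ^ 2 ^ s % d               ≡⟨ cong (_% d) 9^2^s≡1+q*2^[3+s] ⟩
    (1 + q * 2 ^ (3 + s)) % d   ≡⟨ cong (λ e → (1 + q * e) % d) 2^[3+s]≡r*d ⟩
    (1 + q * (r * d)) % d       ≡⟨ cong (λ e → (1 + e) % d) (*-assoc q r d) ⟨
    (1 + q * r * d) % d         ≡⟨ [m+kn]%n≡m%n 1 (q * r) d ⟩
    1 % d                       ∎

module GroupProperties {c ℓ : Level} (G : Group c ℓ) where
  open Group G renaming (refl to ≈-refl)
  open GP G
  open SR (Group.setoid G)
  open Mult monoid using (×-homo-+; ×-assocˡ) renaming (_×_ to _·ⁿ_)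

  pow≡·ⁿ : ∀ x k → pow G x k ≡ k ·ⁿ x
  pow≡·ⁿ x zero    = ≡.refl
  pow≡·ⁿ x (suc k) = cong (x ∙_) (pow≡·ⁿ x k)

  pow-+ : ∀ x i j → pow G x (i + j) ≈ pow G x i ∙ pow G x j
  pow-+ x i j rewrite pow≡·ⁿ x (i + j) | pow≡·ⁿ x i | pow≡·ⁿ x j = ×-homo-+ x i j

  pow-pow : ∀ x i j → pow G (pow G x j) i ≈ pow G x (i * j)
  pow-pow x i j rewrite pow≡·ⁿ x j | pow≡·ⁿ (j ·ⁿ x) i | pow≡·ⁿ x (i * j) = ×-assocˡ x i j

  pow-multiple : ∀ {x d} → pow G x d ≈ ε → ∀ k → pow G x (k * d) ≈ ε
  pow-multiple xᵈ≈ε zero    = ≈-refl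
  pow-multiple {x} {d} xᵈ≈ε (suc k) = begin
    pow G x (d + k * d)           ≈⟨ pow-+ x d (k * d) ⟩
    pow G x d ∙ pow G x (k * d)   ≈⟨ ∙-cong xᵈ≈ε (pow-multiple xᵈ≈ε k) ⟩
    ε ∙ ε                         ≈⟨ identityˡ ε ⟩
    ε                             ∎

  pow-cong-mod : ∀ {x d} .{{_ : NonZero d}} → pow G x d ≈ ε →
                 ∀ {i j} → i ≡ j [mod d ] → pow G x i ≈ pow G x j
  pow-cong-mod {x} {d} xᵈ≈ε {i} {j} i≡j = begin
    pow G x i        ≈⟨ reduce i ⟩
    pow G x (i % d)  ≡⟨ cong (pow G x) i≡j ⟩
    pow G x (j % d)  ≈⟨ reduce j ⟨
    pow G x j        ∎
    where
    reduce : ∀ k → pow G x k ≈ pow G x (k % d)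
    reduce k = begin
      pow G x k                                ≡⟨ cong (pow G x) (m≡m%n+[m/n]*n k d) ⟩
      pow G x (k % d + k / d * d)              ≈⟨ pow-+ x (k % d) (k / d * d) ⟩
      pow G x (k % d) ∙ pow G x (k / d * d)    ≈⟨ ∙-congˡ (pow-multiple xᵈ≈ε (k / d)) ⟩
      pow G x (k % d) ∙ ε                      ≈⟨ identityʳ _ ⟩
      pow G x (k % d)                          ∎

  x⁻¹∙y≈ε⇒x≈y : ∀ {x y} → x ⁻¹ ∙ y ≈ ε → x ≈ y
  x⁻¹∙y≈ε⇒x≈y {x} {y} x⁻¹∙y≈ε = ⁻¹-injective (inverseˡ-unique (x ⁻¹) y x⁻¹∙y≈ε)

  x≈y⇒x⁻¹∙y≈ε : ∀ {x y} → x ≈ y → x ⁻¹ ∙ y ≈ ε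
  x≈y⇒x⁻¹∙y≈ε {x} x≈y = trans (∙-congˡ (sym x≈y)) (inverseˡ x)

  commutative⇒comm≈ε : (∀ x y → x ∙ y ≈ y ∙ x) → ∀ x y → comm G x y ≈ ε
  commutative⇒comm≈ε ∙-comm x y = begin
    ((x ⁻¹ ∙ y ⁻¹) ∙ x) ∙ y   ≈⟨ ∙-congʳ (∙-comm _ x) ⟩
    (x ∙ (x ⁻¹ ∙ y ⁻¹)) ∙ y   ≈⟨ ∙-congʳ (assoc x (x ⁻¹) (y ⁻¹)) ⟨
    ((x ∙ x ⁻¹) ∙ y ⁻¹) ∙ y   ≈⟨ ∙-congʳ (∙-congʳ (inverseʳ x)) ⟩
    (ε ∙ y ⁻¹) ∙ y            ≈⟨ ∙-congʳ (identityˡ (y ⁻¹)) ⟩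
    y ⁻¹ ∙ y                  ≈⟨ inverseˡ y ⟩
    ε                         ∎

  pow∈Derived : ∀ {x} → InDerived G x → ∀ k → InDerived G (pow G x k)
  pow∈Derived x∈G′ zero    = d-ε
  pow∈Derived x∈G′ (suc k) = d-∙ x∈G′ (pow∈Derived x∈G′ k)

  powℤ∈Derived : ∀ {x} → InDerived G x → ∀ k → InDerived G (powℤ G x k)
  powℤ∈Derived x∈G′ (+ k)    = pow∈Derived x∈G′ k
  powℤ∈Derived x∈G′ -[1+ k ] = d-⁻¹ (pow∈Derived x∈G′ (suc k))

  module _ {x y : Carrier} {t : ℕ} (x∙y≈y∙xᵗ : x ∙ y ≈ y ∙ pow G x t) where

    powˡ-∙-swap : ∀ i → pow G x i ∙ y ≈ y ∙ pow G x (i * t)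
    powˡ-∙-swap zero    = trans (identityˡ y) (sym (identityʳ y))
    powˡ-∙-swap (suc i) = begin
      (x ∙ pow G x i) ∙ y             ≈⟨ assoc x _ y ⟩
      x ∙ (pow G x i ∙ y)             ≈⟨ ∙-congˡ (powˡ-∙-swap i) ⟩
      x ∙ (y ∙ pow G x (i * t))       ≈⟨ assoc x y _ ⟨
      (x ∙ y) ∙ pow G x (i * t)       ≈⟨ ∙-congʳ x∙y≈y∙xᵗ ⟩
      (y ∙ pow G x t) ∙ pow G x (i * t) ≈⟨ assoc y _ _ ⟩
      y ∙ (pow G x t ∙ pow G x (i * t)) ≈⟨ ∙-congˡ (pow-+ x t (i * t)) ⟨
      y ∙ pow G x (t + i * t)         ∎

    pow-∙-pow-swap : ∀ i l → pow G x i ∙ pow G y l ≈ pow G y l ∙ pow G x (i * t ^ l)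
    pow-∙-pow-swap i zero = begin
      pow G x i ∙ ε        ≈⟨ identityʳ _ ⟩
      pow G x i            ≡⟨ cong (pow G x) (*-identityʳ i) ⟨
      pow G x (i * 1)      ≈⟨ identityˡ _ ⟨
      ε ∙ pow G x (i * 1)  ∎
    pow-∙-pow-swap i (suc l) = begin
      pow G x i ∙ (y ∙ pow G y l)                  ≈⟨ assoc _ y _ ⟨
      (pow G x i ∙ y) ∙ pow G y l                  ≈⟨ ∙-congʳ (powˡ-∙-swap i) ⟩
      (y ∙ pow G x (i * t)) ∙ pow G y l            ≈⟨ assoc y _ _ ⟩
      y ∙ (pow G x (i * t) ∙ pow G y l)            ≈⟨ ∙-congˡ (pow-∙-pow-swap (i * t) l) ⟩
      y ∙ (pow G y l ∙ pow G x (i * t * t ^ l))    ≈⟨ assoc y _ _ ⟨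
      (y ∙ pow G y l) ∙ pow G x (i * t * t ^ l)    ≡⟨ cong (λ e → (y ∙ pow G y l) ∙ pow G x e) (*-assoc i t (t ^ l)) ⟩
      (y ∙ pow G y l) ∙ pow G x (i * (t * t ^ l))  ∎

    normal-form-∙ : ∀ j i l k → (pow G y j ∙ pow G x i) ∙ (pow G y l ∙ pow G x k)
                                ≈ pow G y (j + l) ∙ pow G x (i * t ^ l + k)
    normal-form-∙ j i l k = begin
      (yʲ ∙ xⁱ) ∙ (yˡ ∙ xᵏ)                          ≈⟨ assoc yʲ xⁱ _ ⟩
      yʲ ∙ (xⁱ ∙ (yˡ ∙ xᵏ))                          ≈⟨ ∙-congˡ (assoc xⁱ yˡ xᵏ) ⟨
      yʲ ∙ ((xⁱ ∙ yˡ) ∙ xᵏ)                          ≈⟨ ∙-congˡ (∙-congʳ (pow-∙-pow-swap i l)) ⟩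
      yʲ ∙ ((yˡ ∙ pow G x (i * t ^ l)) ∙ xᵏ)         ≈⟨ ∙-congˡ (assoc yˡ _ xᵏ) ⟩
      yʲ ∙ (yˡ ∙ (pow G x (i * t ^ l) ∙ xᵏ))         ≈⟨ assoc yʲ yˡ _ ⟨
      (yʲ ∙ yˡ) ∙ (pow G x (i * t ^ l) ∙ xᵏ)         ≈⟨ ∙-cong (pow-+ y j l) (pow-+ x (i * t ^ l) k) ⟨
      pow G y (j + l) ∙ pow G x (i * t ^ l + k)      ∎
      where
      yʲ = pow G y j
      xⁱ = pow G x i
      yˡ = pow G y l
      xᵏ = pow G x k

-- ℤ/n ⋉ ℤ/m: the pair (j , i) stands for bʲaⁱ, and b acts on ⟨a⟩ ≅ ℤ/m by a ↦ aᵗ.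
module Metacyclic (m n t : ℕ) .{{_ : NonZero m}} .{{_ : NonZero n}} (tⁿ≡1 : t ^ n ≡ 1 [mod m ]) where

  infix  4 _≈_
  infixl 7 _∙_
  infix  8 _⁻¹

  -- A record rather than a Pointwise product, so that unification can recover x and y.
  record _≈_ (x y : ℕ × ℕ) : Set where
    constructor _,_
    field
      b-exponent : proj₁ x ≡ proj₁ y [mod n ]
      a-exponent : proj₂ x ≡ proj₂ y [mod m ]
  open _≈_ public

  _∙_ : ℕ × ℕ → ℕ × ℕ → ℕ × ℕ
  (j , i) ∙ (l , k) = j + l , i * t ^ l + k

  -- n ∸ 1 and m ∸ 1 play the role of −1 in ℤ/n and ℤ/m.
  _⁻¹ : ℕ × ℕ → ℕ × ℕ
  (j , i) ⁻¹ = (n ∸ 1) * j , (m ∸ 1) * (i * t ^ ((n ∸ 1) * j))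

  ≈-refl : ∀ {x} → x ≈ x
  ≈-refl = refl , refl

  ≈-sym : ∀ {x y} → x ≈ y → y ≈ x
  ≈-sym (j≡j′ , i≡i′) = ≡.sym j≡j′ , ≡.sym i≡i′

  ≈-trans : ∀ {x y z} → x ≈ y → y ≈ z → x ≈ z
  ≈-trans (j≡j′ , i≡i′) (j′≡j″ , i′≡i″) = ≡.trans j≡j′ j′≡j″ , ≡.trans i≡i′ i′≡i″

  ≡⇒≈ : ∀ {x y} → x ≡ y → x ≈ y
  ≡⇒≈ refl = ≈-refl

  t^-cong : ∀ {l l′} → l ≡ l′ [mod n ] → t ^ l ≡ t ^ l′ [mod m ]
  t^-cong = ^-congʳ-mod tⁿ≡1

  ∙-cong : ∀ {x x′ y y′} → x ≈ x′ → y ≈ y′ → x ∙ y ≈ x′ ∙ y′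
  ∙-cong (j≡j′ , i≡i′) (l≡l′ , k≡k′) =
    +-cong-mod j≡j′ l≡l′ , +-cong-mod (*-cong-mod i≡i′ (t^-cong l≡l′)) k≡k′

  ⁻¹-cong : ∀ {x x′} → x ≈ x′ → x ⁻¹ ≈ x′ ⁻¹
  ⁻¹-cong (j≡j′ , i≡i′) = *-cong-mod {x = n ∸ 1} refl j≡j′ ,
    *-cong-mod {x = m ∸ 1} refl (*-cong-mod i≡i′ (t^-cong (*-cong-mod {x = n ∸ 1} refl j≡j′)))

  assoc : ∀ x y z → (x ∙ y) ∙ z ≈ x ∙ (y ∙ z)
  assoc (j₁ , i₁) (j₂ , i₂) (j₃ , i₃) = ≡⇒≈ (cong₂ _,_ (+-assoc j₁ j₂ j₃) (begin
    (i₁ * t ^ j₂ + i₂) * t ^ j₃ + i₃       ≡⟨ distrib i₁ (t ^ j₂) i₂ (t ^ j₃) i₃ ⟩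
    i₁ * (t ^ j₂ * t ^ j₃) + (i₂ * t ^ j₃ + i₃) ≡⟨ cong (λ e → i₁ * e + _) (^-distribˡ-+-* t j₂ j₃) ⟨
    i₁ * t ^ (j₂ + j₃) + (i₂ * t ^ j₃ + i₃) ∎))
    where
    open ≡-Reasoning
    distrib : ∀ i₁ T₂ i₂ T₃ i₃ → (i₁ * T₂ + i₂) * T₃ + i₃ ≡ i₁ * (T₂ * T₃) + (i₂ * T₃ + i₃)
    distrib = solve-∀

  identityˡ : ∀ x → (0 , 0) ∙ x ≈ x
  identityˡ x = ≡⇒≈ refl

  identityʳ : ∀ x → x ∙ (0 , 0) ≈ x
  identityʳ (j , i) = ≡⇒≈ (cong₂ _,_ (+-identityʳ j) (≡.trans (+-identityʳ _) (*-identityʳ i)))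

  inverseˡ : ∀ x → x ⁻¹ ∙ x ≈ (0 , 0)
  inverseˡ (j , i) = [d∸1]*x+x≡0 j , (begin
    (M * (i * t ^ (N * j)) * t ^ j + i) % m  ≡⟨ cong (λ e → (e + i) % m) (regroup M i (t ^ (N * j)) (t ^ j)) ⟩
    (M * i * (t ^ (N * j) * t ^ j) + i) % m  ≡⟨ cong (λ e → (M * i * e + i) % m) (^-distribˡ-+-* t (N * j) j) ⟨
    (M * i * t ^ (N * j + j) + i) % m        ≡⟨ +-cong-mod (*-cong-mod {x = M * i} refl tᴺʲ⁺ʲ≡1) refl ⟩
    (M * i * 1 + i) % m                      ≡⟨ cong (λ e → (e + i) % m) (*-identityʳ (M * i)) ⟩
    (M * i + i) % m                          ≡⟨ [d∸1]*x+x≡0 i ⟩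
    0 % m                                    ∎)
    where
    open ≡-Reasoning
    M = m ∸ 1
    N = n ∸ 1
    tᴺʲ⁺ʲ≡1 : t ^ (N * j + j) ≡ 1 [mod m ]
    tᴺʲ⁺ʲ≡1 = t^-cong ([d∸1]*x+x≡0 j)
    regroup : ∀ M i T T′ → M * (i * T) * T′ ≡ M * i * (T * T′)
    regroup = solve-∀

  inverseʳ : ∀ x → x ∙ x ⁻¹ ≈ (0 , 0)
  inverseʳ (j , i) = x+[d∸1]*x≡0 j , x+[d∸1]*x≡0 (i * t ^ ((n ∸ 1) * j))

  group : Group 0ℓ 0ℓ
  group = record
    { Carrier = ℕ × ℕ
    ; _≈_ = _≈_
    ; _∙_ = _∙_
    ; ε = 0 , 0
    ; _⁻¹ = _⁻¹
    ; isGroup = record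
      { isMonoid = record
        { isSemigroup = record
          { isMagma = record
            { isEquivalence = record { refl = ≈-refl ; sym = ≈-sym ; trans = ≈-trans }
            ; ∙-cong = ∙-cong
            }
          ; assoc = assoc
          }
        ; identity = identityˡ , identityʳ
        }
      ; inverse = inverseˡ , inverseʳ
      ; ⁻¹-cong = ⁻¹-cong
      }
    }

  a b : ℕ × ℕ
  a = 0 , 1
  b = 1 , 0

  pow-a : ∀ k → pow group a k ≡ (0 , k)
  pow-a zero = refl
  pow-a (suc k) rewrite pow-a k = refl

  pow-b : ∀ k → pow group b k ≡ (k , 0)
  pow-b zero = refl
  pow-b (suc k) rewrite pow-b k = refl

  aᵏ≈ε : ∀ k → k ≡ 0 [mod m ] → pow group a k ≈ (0 , 0)
  aᵏ≈ε k k≡0 rewrite pow-a k = refl , k≡0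

  bᵏ≈ε : ∀ k → k ≡ 0 [mod n ] → pow group b k ≈ (0 , 0)
  bᵏ≈ε k k≡0 rewrite pow-b k = k≡0 , refl

  [b,a]≈a⁴ : t + 3 ≡ 0 [mod m ] → comm group b a ≈ (0 , 4)
  [b,a]≈a⁴ t+3≡0 rewrite *-zeroʳ (n ∸ 1) | *-zeroʳ (m ∸ 1) =
    ≡.trans (cong (_% n) (simplify₁ (n ∸ 1))) ([d∸1]*x+x≡0 1) ,
    ≡.trans (cong (_% m) (simplify₂ (m ∸ 1) t)) ([d∸1]*t+1≡4 t+3≡0)
    where
    simplify₁ : ∀ N → N * 1 + 0 + 1 + 0 ≡ N * 1 + 1
    simplify₁ = solve-∀
    simplify₂ : ∀ M t → ((0 * 1 + M * 1) * (t * 1) + 0) * 1 + 1 ≡ M * t + 1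
    simplify₂ = solve-∀

module CyclicProduct (m n : ℕ) .{{_ : NonZero m}} .{{_ : NonZero n}} where

  1ⁿ≡1 : 1 ^ n ≡ 1 [mod m ]
  1ⁿ≡1 = cong (_% m) (^-zeroˡ n)

  open Metacyclic m n 1 1ⁿ≡1 public

  ∙-comm : ∀ x y → x ∙ y ≈ y ∙ x
  ∙-comm (j , i) (l , k) = cong (_% n) (+-comm j l) , cong (_% m) (begin
    i * 1 ^ l + k  ≡⟨ cong (_+ k) (x*1^l≡x i l) ⟩
    i + k          ≡⟨ +-comm i k ⟩
    k + i          ≡⟨ cong (_+ i) (x*1^l≡x k j) ⟨
    k * 1 ^ j + i  ∎)
    where open ≡-Reasoning

powW≡pow : ∀ {m n} w k → powW w k ≡ pow (Pres m n) w k
powW≡pow w zero    = refl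
powW≡pow w (suc k) = cong (w ·_) (powW≡pow w k)

module _ {c ℓ : Level} (H : Group c ℓ) (x y : Group.Carrier H) where
  open Group H renaming (refl to ≈-refl)

  evalWord : Word → Carrier
  evalWord ga      = x
  evalWord gb      = y
  evalWord e       = ε
  evalWord (u · v) = evalWord u ∙ evalWord v
  evalWord (inv u) = evalWord u ⁻¹

  evalWord-powW : ∀ w k → evalWord (powW w k) ≡ pow H (evalWord w) k
  evalWord-powW w zero    = ≡.refl
  evalWord-powW w (suc k) = cong (evalWord w ∙_) (evalWord-powW w k)

  evalWord-pow : ∀ {m n} w k → evalWord (pow (Pres m n) w k) ≡ pow H (evalWord w) k
  evalWord-pow w zero    = ≡.refl
  evalWord-pow w (suc k) = cong (evalWord w ∙_) (evalWord-pow w k)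

  module _ {m n : ℕ} (xᵐ≈ε : pow H x m ≈ ε) (yⁿ≈ε : pow H y n ≈ ε)
           ([y,x]≈x⁴ : comm H y x ≈ pow H x 4) where

    evalWord-cong : ∀ {u v} → _∼_ m n u v → evalWord u ≈ evalWord v
    evalWord-cong ∼-refl          = ≈-refl
    evalWord-cong (∼-sym u∼v)     = sym (evalWord-cong u∼v)
    evalWord-cong (∼-trans u∼v v∼w) = trans (evalWord-cong u∼v) (evalWord-cong v∼w)
    evalWord-cong (∼-· u∼u′ v∼v′) = ∙-cong (evalWord-cong u∼u′) (evalWord-cong v∼v′)
    evalWord-cong (∼-inv u∼u′)    = ⁻¹-cong (evalWord-cong u∼u′)
    evalWord-cong (∼-assoc u v w) = assoc _ _ _
    evalWord-cong (∼-idˡ u)       = identityˡ _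
    evalWord-cong (∼-idʳ u)       = identityʳ _
    evalWord-cong (∼-invˡ u)      = inverseˡ _
    evalWord-cong (∼-invʳ u)      = inverseʳ _
    evalWord-cong rel-a           = trans (reflexive (evalWord-powW ga m)) xᵐ≈ε
    evalWord-cong rel-b           = trans (reflexive (evalWord-powW gb n)) yⁿ≈ε
    evalWord-cong rel-ba          = [y,x]≈x⁴

    evalWord-derived : (∀ u v → u ∙ v ≈ v ∙ u) → ∀ {w} → InDerived (Pres m n) w → evalWord w ≈ ε
    evalWord-derived ∙-comm (d-comm u v) =
      GroupProperties.commutative⇒comm≈ε H ∙-comm (evalWord u) (evalWord v)
    evalWord-derived ∙-comm d-ε = ≈-refl
    evalWord-derived ∙-comm (d-∙ u∈G′ v∈G′) =
      trans (∙-cong (evalWord-derived ∙-comm u∈G′) (evalWord-derived ∙-comm v∈G′)) (identityˡ ε)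
    evalWord-derived ∙-comm (d-⁻¹ u∈G′) =
      trans (⁻¹-cong (evalWord-derived ∙-comm u∈G′)) (GP.ε⁻¹≈ε H)
    evalWord-derived ∙-comm (d-resp u∼v u∈G′) =
      trans (sym (evalWord-cong u∼v)) (evalWord-derived ∙-comm u∈G′)

module Presentation (m n t : ℕ) .{{_ : NonZero m}} .{{_ : NonZero n}}
                    (t+3≡0 : t + 3 ≡ 0 [mod m ]) (tⁿ≡1 : t ^ n ≡ 1 [mod m ]) where

  G : Group 0ℓ 0ℓ
  G = Pres m n

  open Group G
    using (_≈_; _∙_; ε; _⁻¹; sym; trans; reflexive; ∙-cong; ∙-congˡ; ∙-congʳ; ⁻¹-cong;
           assoc; identityˡ; identityʳ; inverseˡ; inverseʳ)
    renaming (refl to ≈-refl)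
  open GroupProperties G
  open GP G using (inverseˡ-unique; ⁻¹-anti-homo-∙; ⁻¹-involutive; ∙-cancelʳ)
  open SR (Group.setoid G)
  module Model = Metacyclic m n t tⁿ≡1
  open Model using (_,_)

  aᵐ≈ε : pow G ga m ≈ ε
  aᵐ≈ε = trans (reflexive (≡.sym (powW≡pow ga m))) rel-a

  bⁿ≈ε : pow G gb n ≈ ε
  bⁿ≈ε = trans (reflexive (≡.sym (powW≡pow gb n))) rel-b

  b⁻¹∙a∙b≈aᵗ : gb ⁻¹ ∙ (ga ∙ gb) ≈ pow G ga t
  b⁻¹∙a∙b≈aᵗ = begin
    gb ⁻¹ ∙ (ga ∙ gb)                    ≈⟨ ∙-congˡ (∙-cong (⁻¹-involutive ga) (⁻¹-involutive gb)) ⟨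
    gb ⁻¹ ∙ (ga ⁻¹ ⁻¹ ∙ gb ⁻¹ ⁻¹)        ≈⟨ ∙-congˡ (⁻¹-anti-homo-∙ (gb ⁻¹) (ga ⁻¹)) ⟨
    gb ⁻¹ ∙ (gb ⁻¹ ∙ ga ⁻¹) ⁻¹           ≈⟨ ⁻¹-anti-homo-∙ (gb ⁻¹ ∙ ga ⁻¹) gb ⟨
    ((gb ⁻¹ ∙ ga ⁻¹) ∙ gb) ⁻¹            ≈⟨ ⁻¹-cong [b⁻¹a⁻¹]b≈a³ ⟩
    pow G ga 3 ⁻¹                        ≈⟨ inverseˡ-unique (pow G ga t) (pow G ga 3) aᵗ∙a³≈ε ⟨
    pow G ga t                           ∎
    where
    [b⁻¹a⁻¹]b≈a³ : (gb ⁻¹ ∙ ga ⁻¹) ∙ gb ≈ pow G ga 3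
    [b⁻¹a⁻¹]b≈a³ = ∙-cancelʳ ga _ _ (begin
      ((gb ⁻¹ ∙ ga ⁻¹) ∙ gb) ∙ ga   ≈⟨ rel-ba ⟩
      pow G ga (3 + 1)              ≈⟨ pow-+ ga 3 1 ⟩
      pow G ga 3 ∙ (ga ∙ ε)         ≈⟨ ∙-congˡ (identityʳ ga) ⟩
      pow G ga 3 ∙ ga               ∎)
    aᵗ∙a³≈ε : pow G ga t ∙ pow G ga 3 ≈ ε
    aᵗ∙a³≈ε = trans (sym (pow-+ ga t 3)) (pow-cong-mod aᵐ≈ε t+3≡0)

  a∙b≈b∙aᵗ : ga ∙ gb ≈ gb ∙ pow G ga t
  a∙b≈b∙aᵗ = begin
    ga ∙ gb                   ≈⟨ identityˡ _ ⟨
    ε ∙ (ga ∙ gb)             ≈⟨ ∙-congʳ (inverseʳ gb) ⟨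
    (gb ∙ gb ⁻¹) ∙ (ga ∙ gb)  ≈⟨ assoc gb _ _ ⟩
    gb ∙ (gb ⁻¹ ∙ (ga ∙ gb))  ≈⟨ ∙-congˡ b⁻¹∙a∙b≈aᵗ ⟩
    gb ∙ pow G ga t           ∎

  nf : ℕ × ℕ → Word
  nf (j , i) = pow G gb j ∙ pow G ga i

  nf-∙ : ∀ p q → nf p ∙ nf q ≈ nf (p Model.∙ q)
  nf-∙ (j , i) (l , k) = normal-form-∙ a∙b≈b∙aᵗ j i l k

  nf-cong : ∀ {p q} → p Model.≈ q → nf p ≈ nf q
  nf-cong (j≡l , i≡k) = ∙-cong (pow-cong-mod bⁿ≈ε j≡l) (pow-cong-mod aᵐ≈ε i≡k)

  nf-⁻¹ : ∀ p → nf (p Model.⁻¹) ≈ nf p ⁻¹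
  nf-⁻¹ p = inverseˡ-unique _ _
    (trans (nf-∙ (p Model.⁻¹) p) (trans (nf-cong (Model.inverseˡ p)) (identityˡ ε)))

  eval : Word → ℕ × ℕ
  eval = evalWord Model.group Model.a Model.b

  nf-eval : ∀ w → nf (eval w) ≈ w
  nf-eval ga      = trans (identityˡ _) (identityʳ ga)
  nf-eval gb      = trans (identityʳ _) (identityʳ gb)
  nf-eval e       = identityˡ ε
  nf-eval (u · v) = trans (sym (nf-∙ (eval u) (eval v))) (∙-cong (nf-eval u) (nf-eval v))
  nf-eval (inv u) = trans (nf-⁻¹ (eval u)) (⁻¹-cong (nf-eval u))

  module _ (m′ n′ t′ : ℕ) .{{_ : NonZero m′}} .{{_ : NonZero n′}} (t′ⁿ′≡1 : t′ ^ n′ ≡ 1 [mod m′ ]) where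
    open Metacyclic m′ n′ t′ t′ⁿ′≡1
      using (group; a; b; pow-a; pow-b; ≡⇒≈) renaming (_≈_ to _≈′_; _∙_ to _∙′_)

    evalWord-nf : ∀ p → evalWord group a b (nf p) ≈′ p
    evalWord-nf (j , i) = ≡⇒≈ (≡.trans
      (cong₂ _∙′_ (≡.trans (evalWord-pow group a b gb j) (pow-b j))
                  (≡.trans (evalWord-pow group a b ga i) (pow-a i)))
      (cong (_, i) (+-identityʳ j)))

  model-aᵐ≈ε : pow Model.group Model.a m Model.≈ (0 , 0)
  model-aᵐ≈ε = Model.aᵏ≈ε m (∣⇒≡0-mod ∣-refl)

  model-bⁿ≈ε : pow Model.group Model.b n Model.≈ (0 , 0)
  model-bⁿ≈ε = Model.bᵏ≈ε n (∣⇒≡0-mod ∣-refl)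

  model-[b,a]≈a⁴ : comm Model.group Model.b Model.a Model.≈ pow Model.group Model.a 4
  model-[b,a]≈a⁴ = Model.[b,a]≈a⁴ t+3≡0

  eval-cong : ∀ {u v} → u ≈ v → eval u Model.≈ eval v
  eval-cong = evalWord-cong Model.group Model.a Model.b {m} {n} model-aᵐ≈ε model-bⁿ≈ε model-[b,a]≈a⁴

  eval-nf : ∀ p → eval (nf p) Model.≈ p
  eval-nf = evalWord-nf m n t tⁿ≡1

  nf-injective : ∀ {p q} → nf p ≈ nf q → p Model.≈ q
  nf-injective {p} {q} nfp≈nfq =
    Model.≈-trans (Model.≈-sym (eval-nf p)) (Model.≈-trans (eval-cong nfp≈nfq) (eval-nf q))

  aᵏ≈ε⇒k≡0 : ∀ {k} → pow G ga k ≈ ε → k ≡ 0 [mod m ]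
  aᵏ≈ε⇒k≡0 {k} aᵏ≈ε = Model.a-exponent (nf-injective {0 , k} {0 , 0} nf[0,k]≈nf[0,0])
    where
    nf[0,k]≈nf[0,0] : ε ∙ pow G ga k ≈ ε ∙ ε
    nf[0,k]≈nf[0,0] = ∙-congˡ aᵏ≈ε

  nf-bijection : Bijection (≡.setoid (Fin m × Fin n)) (Group.setoid G)
  nf-bijection = record
    { to        = toWord
    ; cong      = λ { ≡.refl → ≈-refl }
    ; bijective = injective , surjective
    }
    where
    toWord : Fin m × Fin n → Word
    toWord (i , j) = nf (toℕ j , toℕ i)
    injective : ∀ {x y} → toWord x ≈ toWord y → x ≡ y
    injective {i , j} {i′ , j′} eq
      with j≡j′ , i≡i′ ← nf-injective {toℕ j , toℕ i} {toℕ j′ , toℕ i′} eq =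
      cong₂ _,_ (toℕ-injective-mod i≡i′) (toℕ-injective-mod j≡j′)
    surjective : ∀ w → ∃ λ x → ∀ {z} → z ≡ x → toWord z ≈ w
    surjective w = (proj₂ (eval w) mod m , proj₁ (eval w) mod n) , λ { ≡.refl →
      trans (nf-cong (toℕ-mod-≡ (proj₁ (eval w)) , toℕ-mod-≡ (proj₂ (eval w)))) (nf-eval w) }

  Fin[m*n]-bijection : Bijection (≡.setoid (Fin (m * n))) (Group.setoid G)
  Fin[m*n]-bijection = Composition.bijection (Inverse⇒Bijection *↔×) nf-bijection

  module _ (4∣m : 4 ∣ m) where
    module Ab = CyclicProduct 4 n

    ab : Word → ℕ × ℕ
    ab = evalWord Ab.group Ab.a Ab.b

    ab-aᵐ≈ε : pow Ab.group Ab.a m Ab.≈ (0 , 0)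
    ab-aᵐ≈ε = Ab.aᵏ≈ε m (∣⇒≡0-mod 4∣m)

    ab-bⁿ≈ε : pow Ab.group Ab.b n Ab.≈ (0 , 0)
    ab-bⁿ≈ε = Ab.bᵏ≈ε n (∣⇒≡0-mod ∣-refl)

    ab-[b,a]≈a⁴ : comm Ab.group Ab.b Ab.a Ab.≈ pow Ab.group Ab.a 4
    ab-[b,a]≈a⁴ = Ab.[b,a]≈a⁴ refl

    ab-cong : ∀ {u v} → u ≈ v → ab u Ab.≈ ab v
    ab-cong = evalWord-cong Ab.group Ab.a Ab.b {m} {n} ab-aᵐ≈ε ab-bⁿ≈ε ab-[b,a]≈a⁴

    ab-nf : ∀ p → ab (nf p) Ab.≈ p
    ab-nf = evalWord-nf 4 n 1 Ab.1ⁿ≡1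

    G′⊆ker-ab : ∀ {w} → InDerived G w → ab w Ab.≈ (0 , 0)
    G′⊆ker-ab = evalWord-derived Ab.group Ab.a Ab.b {m} {n} ab-aᵐ≈ε ab-bⁿ≈ε ab-[b,a]≈a⁴ Ab.∙-comm

    a⁴ : Word
    a⁴ = powW ga 4

    ker-ab⊆⟨a⁴⟩ : ∀ {w} → ab w Ab.≈ (0 , 0) → InCyclic G a⁴ w
    ker-ab⊆⟨a⁴⟩ {w} abw≈ε = + (i / 4) , (begin
      w                       ≈⟨ nf-eval w ⟨
      nf (j , i)              ≈⟨ nf-cong {j , i} {0 , i} (j≡0 , refl) ⟩
      ε ∙ pow G ga i          ≈⟨ identityˡ _ ⟩
      pow G ga i              ≡⟨ cong (pow G ga) (m/n*n≡m (m%n≡0⇒n∣m i 4 i≡0)) ⟨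
      pow G ga (i / 4 * 4)    ≈⟨ pow-pow ga (i / 4) 4 ⟨
      pow G a⁴ (i / 4)        ∎)
      where
      j = proj₁ (eval w)
      i = proj₂ (eval w)
      eval-w≈ε : eval w Ab.≈ (0 , 0)
      eval-w≈ε = Ab.≈-trans (Ab.≈-sym (ab-nf (eval w)))
                   (Ab.≈-trans (ab-cong (nf-eval w)) abw≈ε)
      j≡0 : j ≡ 0 [mod n ]
      j≡0 = Ab.b-exponent eval-w≈ε
      i≡0 : i % 4 ≡ 0
      i≡0 = Ab.a-exponent eval-w≈ε

    ⟨a⁴⟩⊆G′ : ∀ {w} → InCyclic G a⁴ w → InDerived G w
    ⟨a⁴⟩⊆G′ (k , w≈a⁴ᵏ) = d-resp (sym w≈a⁴ᵏ) (powℤ∈Derived (d-resp rel-ba (d-comm gb ga)) k)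

    G′≡⟨a⁴⟩ : ∀ w → InDerived G w ⇔ InCyclic G a⁴ w
    G′≡⟨a⁴⟩ w = mk⇔ (λ w∈G′ → ker-ab⊆⟨a⁴⟩ (G′⊆ker-ab w∈G′)) ⟨a⁴⟩⊆G′

    order-a⁴ : HasOrder G a⁴ (m / 4)
    order-a⁴ = m≥n⇒m/n>0 (∣⇒≤ 4∣m) , a⁴^[m/4]≈ε , a⁴ʲ≉ε
      where
      a⁴^[m/4]≈ε : pow G a⁴ (m / 4) ≈ ε
      a⁴^[m/4]≈ε = begin
        pow G a⁴ (m / 4)      ≈⟨ pow-pow ga (m / 4) 4 ⟩
        pow G ga (m / 4 * 4)  ≡⟨ cong (pow G ga) (m/n*n≡m 4∣m) ⟩
        pow G ga m            ≈⟨ aᵐ≈ε ⟩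
        ε                     ∎
      a⁴ʲ≉ε : ∀ j → 1 ≤ j → j < m / 4 → ¬ (pow G a⁴ j ≈ ε)
      a⁴ʲ≉ε j@(suc _) _ j<m/4 a⁴ʲ≈ε =
        1+n≢0 (<⇒≡0-mod⇒≡0 4j<m (aᵏ≈ε⇒k≡0 (trans (sym (pow-pow ga j 4)) a⁴ʲ≈ε)))
        where
        4j<m : j * 4 < m
        4j<m = ≡.subst (j * 4 <_) (m/n*n≡m 4∣m) (*-monoˡ-< 4 j<m/4)

    G/G′≅C₄×Cₙ : QuotDerivedIsoCk×Cl G 4 n
    G/G′≅C₄×Cₙ = record { to = to ; cong = to-cong ; bijective = to-injective , to-surjective } , to-homo
      where
      module AbProperties = GroupProperties Ab.group
      toFin : ℕ × ℕ → Fin 4 × Fin n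
      toFin (j , i) = i mod 4 , j mod n
      toFin-cong : ∀ {p q} → p Ab.≈ q → toFin p ≡ toFin q
      toFin-cong {j , i} {l , k} (j≡l Ab., i≡k) =
        cong₂ _,_ (mod-cong {x = i} {k} i≡k) (mod-cong {x = j} {l} j≡l)
      toFin-injective : ∀ p q → toFin p ≡ toFin q → p Ab.≈ q
      toFin-injective (j , i) (l , k) eq =
        mod-injective j l (cong proj₂ eq) Ab., mod-injective i k (cong proj₁ eq)
      to : Word → Fin 4 × Fin n
      to w = toFin (ab w)
      to-cong : ∀ {u v} → InDerived G (u ⁻¹ ∙ v) → to u ≡ to v
      to-cong {u} {v} u⁻¹v∈G′ =
        toFin-cong (AbProperties.x⁻¹∙y≈ε⇒x≈y {ab u} {ab v} (G′⊆ker-ab u⁻¹v∈G′))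
      to-injective : ∀ {u v} → to u ≡ to v → InDerived G (u ⁻¹ ∙ v)
      to-injective {u} {v} tou≡tov = ⟨a⁴⟩⊆G′ (ker-ab⊆⟨a⁴⟩ {u ⁻¹ ∙ v}
        (AbProperties.x≈y⇒x⁻¹∙y≈ε {ab u} {ab v} (toFin-injective (ab u) (ab v) tou≡tov)))
      to-surjective : ∀ x → ∃ λ w → ∀ {z} → InDerived G (z ⁻¹ ∙ w) → to z ≡ x
      to-surjective (i , j) = nf (toℕ j , toℕ i) , λ z⁻¹w∈G′ → ≡.trans (to-cong z⁻¹w∈G′)
        (≡.trans (toFin-cong (ab-nf (toℕ j , toℕ i)))
                 (cong₂ _,_ (toℕ-mod-id i) (toℕ-mod-id j)))
      to-homo : ∀ u v → to (u · v) ≡ addPair (to u) (to v)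
      to-homo u v = cong₂ _,_
        (≡.trans (cong (_mod 4) (cong (_+ proj₂ (ab v)) (x*1^l≡x (proj₂ (ab u)) (proj₁ (ab v)))))
                 (mod-distrib-+ (proj₂ (ab u)) (proj₂ (ab v))))
        (mod-distrib-+ (proj₁ (ab u)) (proj₁ (ab v)))

lemma2 : (m n : ℕ) → IsPow2 m → IsPow2 n → 16 ≤ m → 4 ≤ n → m ≤ 4 * n →
    Bijection (setoid (Fin (m * n))) (Group.setoid (Pres m n))
    × (∀ x → InDerived (Pres m n) x ⇔ InCyclic (Pres m n) (powW ga 4) x)
    × HasOrder (Pres m n) (powW ga 4) (m / 4)
    × QuotDerivedIsoCk×Cl (Pres m n) 4 n
lemma2 _ _ (i , ≡.refl) (zero , ≡.refl) _ (s≤s ()) _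
lemma2 _ _ (i , ≡.refl) (suc s , ≡.refl) 16≤m _ m≤4n =
  Fin[m*n]-bijection , G′≡⟨a⁴⟩ 4∣m , order-a⁴ 4∣m , G/G′≅C₄×Cₙ 4∣m
  where
  m = 2 ^ i
  instance
    m≢0 : NonZero m
    m≢0 = m^n≢0 2 i
    n≢0 : NonZero (2 ^ suc s)
    n≢0 = m^n≢0 2 (suc s)
  3≤m : 3 ≤ m
  3≤m = ≤-trans (s≤s (s≤s (s≤s z≤n))) 16≤m
  4∣m : 4 ∣ m
  4∣m = ^-monoʳ-∣ 2 {2} {i} (≤-trans (s≤s (s≤s z≤n)) (^-cancelʳ-≤ 2 {4} {i} ≤-refl 16≤m))
  m∣2^[3+s] : m ∣ 2 ^ (3 + s)
  m∣2^[3+s] = ^-monoʳ-∣ 2 {i} {3 + s} (^-cancelʳ-≤ 2 {i} {3 + s} ≤-refl m≤2^[3+s])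
    where
    m≤2^[3+s] : m ≤ 2 ^ (3 + s)
    m≤2^[3+s] = ≡.subst (m ≤_) (≡.sym (^-distribˡ-+-* 2 2 (suc s))) m≤4n
  t+3≡0 : m ∸ 3 + 3 ≡ 0 [mod m ]
  t+3≡0 = ≡.trans (cong (_% m) (m∸n+n≡m 3≤m)) (∣⇒≡0-mod ∣-refl)
  open Presentation m (2 ^ suc s) (m ∸ 3) t+3≡0 ([d∸3]^2^[1+s]≡1 3≤m s m∣2^[3+s])
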